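{- Let $G=(V,E)$ be a temporal graph, $s\in V$, $t_s$ real, and $T$ the BFS tree of $G$ rooted at $s$ with starting time $t_s$. Let $V_T$ be the set of distinct vertices having at least one occurrence in $T$, and $V_R$ the set of vertices reachable from $s$ starting at $t_s$. Then $V_T=V_R$.
   Context: A temporal graph is $G=(V,E)$ with $V$ a finite vertex set and $E$ a finite set of temporal edges $(u,v,t)$, $u\neq v$, $t$ real; distinct temporal edges from $u$ to $v$ have distinct times. Reachability: $v$ is reachable from $s$ starting at $t_s$ if $v=s$, or there are temporal edges $(w_1,w_2,t_1),\dots,(w_k,w_{k+1},t_k)\in E$, $k\ge1$, with $w_1=s$, $w_{k+1}=v$ and $t_s\le t_1\le\dots\le t_k$. BFS from $s$ with starting time $t_s$: keep $\sigma(x)$ (time most recently assigned to $x$), initially $\infty$; FIFO queue $Q$ of records $(x,d,\tau,p)$ (vertex, hop count, time, predecessor). Set $\sigma(s)=t_s$, push $(s,0,t_s,\text{none})$. While $Q\neq\emptyset$: pop $(u,d_u,\tau_u,p_u)$; for each out-neighbor $v$ of $u$ with $E_{u,v}\neq\emptyset$, where $E_{u,v}$ is the set of not-yet-traversed edges $(u,v,t)\in E$ with $\tau_u\le t$, traverse the edge $(u,v,t)$ of $E_{u,v}$ of minimum time; then (i) if $Q$ has no record of $v$: if $\sigma(v)>t$, set $\sigma(v)=t$ and push $(v,d_u+1,t,\text{popped record})$; (ii) else if $Q$ has a record of $v$ with hop count $d_u+1$: if $\sigma(v)>t$, set $\sigma(v)=t$ and set that record's time to $t$ and predecessor to the popped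 record; (iii) else (the record of $v$ in $Q$ has hop count $d_u$): if $\sigma(v)>t$, set $\sigma(v)=t$ and push $(v,d_u+1,t,\text{popped record})$. The BFS tree $T$ has as nodes all records ever pushed (each an occurrence of its vertex; the initial one is the root), each non-root record a child of its final predecessor record. -}

module Defs where

open import Level using (Level; _⊔_)
open import Data.Nat using (ℕ; zero; suc)
open import Data.Fin using (Fin; _≟_)
open import Data.Bool using (Bool; true; false)
open import Data.Maybe using (Maybe; just; nothing)
open import Data.List using (List; []; _∷_; _++_; length; [_])
open import Data.List.Membership.Propositional using (_∈_)
open import Data.Product using (Σ; ∃; _×_; _,_)
open import Data.Unit.Polymorphic using (⊤)
open import Relation.Binary.PropositionalEquality using (_≡_; _≢_)
open import Relation.Binary.Bundles using (TotalOrder)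
open import Relation.Binary.Construct.Closure.ReflexiveTransitive using (Star)
open import Relation.Nullary using (¬_; yes; no)

at : ∀ {a} {A : Set a} → List A → ℕ → Maybe A
at []       _       = nothing
at (x ∷ xs) zero    = just x
at (x ∷ xs) (suc k) = at xs k

setAt : ∀ {a} {A : Set a} → List A → ℕ → A → List A
setAt []       _       y = []
setAt (x ∷ xs) zero    y = y ∷ xs
setAt (x ∷ xs) (suc k) y = x ∷ setAt xs k y

upd : ∀ {a} {A : Set a} {k : ℕ} → (Fin k → A) → Fin k → A → Fin k → A
upd f x y z with z ≟ x
... | yes _ = y
... | no  _ = f z

-- Times range over an arbitrary total order (the paper uses the reals;
-- only the order of times matters).
module Temporal {c ℓ₁ ℓ₂} (O : TotalOrder c ℓ₁ ℓ₂) where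
  open TotalOrder O renaming (Carrier to Time)

  _<ᵗ_ : Time → Time → Set (ℓ₁ ⊔ ℓ₂)
  t <ᵗ x = (t ≤ x) × ¬ (t ≈ x)

  record TEdge (n : ℕ) : Set c where
    constructor tedge
    field
      src  : Fin n
      dst  : Fin n
      time : Time
  open TEdge public

  record TemporalGraph : Set (c ⊔ ℓ₁) where
    field
      n m      : ℕ
      edge     : Fin m → TEdge n
      no-loop  : ∀ i → src (edge i) ≢ dst (edge i)
      distinct : ∀ i j → i ≢ j → src (edge i) ≡ src (edge j) →
                 dst (edge i) ≡ dst (edge j) → ¬ (time (edge i) ≈ time (edge j))

  Vtx : TemporalGraph → Set
  Vtx G = Fin (TemporalGraph.n G)

  module _ (G : TemporalGraph) where
    open TemporalGraph G

    data Walk : Fin n → Time → Fin n → Set (c ⊔ ℓ₂) where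
      stay : ∀ {x t} → Walk x t x
      step : ∀ {x t y} (i : Fin m) → src (edge i) ≡ x → t ≤ time (edge i) →
             Walk (dst (edge i)) (time (edge i)) y → Walk x t y

    Reachable : Fin n → Time → Fin n → Set (c ⊔ ℓ₂)
    Reachable s ts v = Walk s ts v

    -- BFS records (vertex, hop count, time, predecessor record id).
    -- Records are identified by their position in the list of all pushed records.
    record Rec : Set c where
      constructor rec
      field
        vtx  : Fin n
        hop  : ℕ
        tm   : Time
        pred : Maybe ℕ
    open Rec public

    -- BFS state: σ (nothing = ∞), traversed edges, all records ever pushed,
    -- FIFO queue of record ids, and the record currently being processed
    -- (popped id, together with the set of neighbours already handled).
    record State : Set c where
      constructor state
      field
        σ     : Fin n → Maybe Time
        trav  : Fin m → Bool
        recs  : List Rec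
        queue : List ℕ
        cur   : Maybe (ℕ × (Fin n → Bool))

    Above : Maybe Time → Time → Set (ℓ₁ ⊔ ℓ₂)
    Above nothing  t = ⊤
    Above (just x) t = t <ᵗ x

    InE : (Fin m → Bool) → Fin n → Time → Fin n → Fin m → Set ℓ₂
    InE tr u τ v i = src (edge i) ≡ u × dst (edge i) ≡ v × tr i ≡ false × τ ≤ time (edge i)

    MinE : (Fin m → Bool) → Fin n → Time → Fin n → Fin m → Set (ℓ₂)
    MinE tr u τ v i = InE tr u τ v i × (∀ j → InE tr u τ v j → time (edge i) ≤ time (edge j))

    HasQ : List Rec → List ℕ → Fin n → ℕ → ℕ → Set c
    HasQ rs q v h k = k ∈ q × Σ Rec λ r → at rs k ≡ just r × vtx r ≡ v × hop r ≡ h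

    -- One elementary step of the BFS (the order in which out-neighbours of the
    -- popped vertex are handled is arbitrary).
    data Step : State → State → Set (c ⊔ ℓ₁ ⊔ ℓ₂) where
      pop    : ∀ {σ tr rs i q} →
               Step (state σ tr rs (i ∷ q) nothing) (state σ tr rs q (just (i , λ _ → false)))
      finish : ∀ {σ tr rs q i done r} → at rs i ≡ just r →
               (∀ v j → done v ≡ false → ¬ InE tr (vtx r) (tm r) v j) →
               Step (state σ tr rs q (just (i , done))) (state σ tr rs q nothing)
      skip   : ∀ {σ tr rs q i done r v j} → at rs i ≡ just r → done v ≡ false →
               MinE tr (vtx r) (tm r) v j → ¬ Above (σ v) (time (edge j)) →
               Step (state σ tr rs q (just (i , done)))
                    (state σ (upd tr j true) rs q (just (i , upd done v true)))
      -- cases (i) and (iii): no record of v with hop d_u+1 in Q: push a new record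
      push   : ∀ {σ tr rs q i done r v j} → at rs i ≡ just r → done v ≡ false →
               MinE tr (vtx r) (tm r) v j → Above (σ v) (time (edge j)) →
               (∀ k → ¬ HasQ rs q v (suc (hop r)) k) →
               Step (state σ tr rs q (just (i , done)))
                    (state (upd σ v (just (time (edge j)))) (upd tr j true)
                           (rs ++ [ rec v (suc (hop r)) (time (edge j)) (just i) ])
                           (q ++ [ length rs ]) (just (i , upd done v true)))
      -- case (ii): record k of v with hop d_u+1 in Q: update its time and predecessor
      update : ∀ {σ tr rs q i done r v j k} → at rs i ≡ just r → done v ≡ false →
               MinE tr (vtx r) (tm r) v j → Above (σ v) (time (edge j)) →
               HasQ rs q v (suc (hop r)) k →
               Step (state σ tr rs q (just (i , done)))
                    (state (upd σ v (just (time (edge j)))) (upd tr j true)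
                           (setAt rs k (rec v (suc (hop r)) (time (edge j)) (just i)))
                           q (just (i , upd done v true)))

    initial : Fin n → Time → State
    initial s ts = state (upd (λ _ → nothing) s (just ts)) (λ _ → false)
                         [ rec s 0 ts nothing ] (0 ∷ []) nothing

    -- A terminated run of the BFS from s with starting time ts, ending with
    -- record list rs (the nodes of the BFS tree).
    BFSRun : Fin n → Time → List Rec → Set (c ⊔ ℓ₁ ⊔ ℓ₂)
    BFSRun s ts rs = ∃ λ σ → ∃ λ tr → Star Step (initial s ts) (state σ tr rs [] nothing)

    InTree : List Rec → Fin n → Set c
    InTree rs v = ∃ λ r → r ∈ rs × vtx r ≡ v

module Submission where

-- The proof is a run invariant.  For a state with estimate σ, traversed
-- edges tr, records rs, queue q and current record cu we maintain:
--   * every record r is sound: whatever is reachable from (vtx r, tm r) is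
--     reachable from (s, ts);
--   * every finite value σ(w) = x is witnessed by a record of w at time x;
--   * every traversed edge e is settled: σ(dst e) ≤ time e;
--   * every record is queued, or is the current one and closed on the
--     neighbours already handled, or closed: all its late-enough out-edges
--     are settled;
--   * σ(s) ≤ ts.
-- The invariant holds initially and each kind of BFS step preserves it.  In
-- a terminal state every record is closed, so following a time-respecting
-- walk edge by edge stays inside the tree (completeness); soundness of the
-- records gives the converse inclusion.  Comparisons σ(w) ≤ t are expressed
-- negatively (¬ t < σ(w)), since the time order is only assumed total.

open import Defs
open import Data.List using (List)
open import Data.Product using (_×_)
open import Relation.Binary.Bundles using (TotalOrder)

open import Level using (_⊔_)
open import Data.Nat using (ℕ; zero; suc) renaming (_≟_ to _≟ℕ_)
open import Data.Fin using (Fin; _≟_)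
open import Data.Bool using (Bool; true; false)
open import Data.Maybe using (Maybe; just; nothing)
open import Data.Maybe.Properties using (just-injective)
open import Data.List using ([]; _∷_; _++_; length; [_])
open import Data.List.Membership.Propositional using (_∈_)
open import Data.List.Membership.Propositional.Properties using (∈-++⁺ˡ; ∈-++⁺ʳ)
open import Data.List.Relation.Unary.Any using (here; there)
open import Data.Product using (∃; _,_)
open import Data.Sum using (_⊎_; inj₁; inj₂)
open import Data.Empty using () renaming (⊥ to ⊥₀; ⊥-elim to ⊥₀-elim)
open import Data.Empty.Polymorphic using (⊥; ⊥-elim)
open import Relation.Binary.PropositionalEquality
  using (_≡_; _≢_; refl; sym; trans; subst; cong)
open import Relation.Binary.Construct.Closure.ReflexiveTransitive using (Star; ε; _◅_)
open import Relation.Nullary using (¬_; yes; no)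

module _ {a} {A : Set a} where

  at-snoc-inv : ∀ (xs : List A) {x k y} → at (xs ++ [ x ]) k ≡ just y →
                at xs k ≡ just y ⊎ (k ≡ length xs × y ≡ x)
  at-snoc-inv []       {k = zero}  eq = inj₂ (refl , sym (just-injective eq))
  at-snoc-inv []       {k = suc k} ()
  at-snoc-inv (_ ∷ xs) {k = zero}  eq = inj₁ eq
  at-snoc-inv (_ ∷ xs) {k = suc k} eq with at-snoc-inv xs eq
  ... | inj₁ old          = inj₁ old
  ... | inj₂ (k≡ , y≡x) = inj₂ (cong suc k≡ , y≡x)

  at-++ˡ : ∀ (xs : List A) {ys k y} → at xs k ≡ just y → at (xs ++ ys) k ≡ just y
  at-++ˡ (_ ∷ xs) {k = zero}  eq = eq
  at-++ˡ (_ ∷ xs) {k = suc k} eq = at-++ˡ xs eq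

  at-snoc-last : ∀ (xs : List A) x → at (xs ++ [ x ]) (length xs) ≡ just x
  at-snoc-last []       x = refl
  at-snoc-last (_ ∷ xs) x = at-snoc-last xs x

  at-setAt-inv : ∀ (xs : List A) k {y k' z} → at (setAt xs k y) k' ≡ just z →
                 (k' ≡ k × z ≡ y) ⊎ at xs k' ≡ just z
  at-setAt-inv []       _       ()
  at-setAt-inv (_ ∷ xs) zero    {k' = zero}   eq = inj₁ (refl , sym (just-injective eq))
  at-setAt-inv (_ ∷ xs) zero    {k' = suc k'} eq = inj₂ eq
  at-setAt-inv (_ ∷ xs) (suc k) {k' = zero}   eq = inj₂ eq
  at-setAt-inv (_ ∷ xs) (suc k) {k' = suc k'} eq with at-setAt-inv xs k eq
  ... | inj₁ (k'≡k , z≡y) = inj₁ (cong suc k'≡k , z≡y)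
  ... | inj₂ old          = inj₂ old

  at-setAt-here : ∀ (xs : List A) k {y z} → at xs k ≡ just z → at (setAt xs k y) k ≡ just y
  at-setAt-here (_ ∷ xs) zero    _  = refl
  at-setAt-here (_ ∷ xs) (suc k) eq = at-setAt-here xs k eq

  at-setAt-there : ∀ (xs : List A) k {y k'} → k' ≢ k → at (setAt xs k y) k' ≡ at xs k'
  at-setAt-there []       _       _                 = refl
  at-setAt-there (_ ∷ xs) zero    {k' = zero}   k'≢k = ⊥₀-elim (k'≢k refl)
  at-setAt-there (_ ∷ xs) zero    {k' = suc k'} _    = refl
  at-setAt-there (_ ∷ xs) (suc k) {k' = zero}   _    = refl
  at-setAt-there (_ ∷ xs) (suc k) {k' = suc k'} k'≢k =
    at-setAt-there xs k (λ eq → k'≢k (cong suc eq))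

  at⇒∈ : ∀ {xs : List A} {k y} → at xs k ≡ just y → y ∈ xs
  at⇒∈ {_ ∷ xs} {zero}  eq = here (sym (just-injective eq))
  at⇒∈ {_ ∷ xs} {suc k} eq = there (at⇒∈ eq)

  ∈⇒at : ∀ {xs : List A} {y} → y ∈ xs → ∃ λ k → at xs k ≡ just y
  ∈⇒at (here y≡x) = zero , cong just (sym y≡x)
  ∈⇒at (there y∈) with ∈⇒at y∈
  ... | k , eq = suc k , eq

upd-case : ∀ {a} {A : Set a} {k : ℕ} (f : Fin k → A) x y z →
           (z ≡ x × upd f x y z ≡ y) ⊎ (z ≢ x × upd f x y z ≡ f z)
upd-case f x y z with z ≟ x
... | yes z≡x = inj₁ (z≡x , refl)
... | no  z≢x = inj₂ (z≢x , refl)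

module BFSInvariant {c ℓ₁ ℓ₂} (O : TotalOrder c ℓ₁ ℓ₂) (G : Temporal.TemporalGraph O) where
  open TotalOrder O using (_≤_; antisym; total; reflexive; module Eq)
    renaming (Carrier to Time; trans to ≤-trans)
  open Temporal O
  open TemporalGraph G

  _≼_ : Maybe Time → Time → Set (ℓ₁ ⊔ ℓ₂)
  m ≼ t = ¬ Above G m t

  ≼-refl : ∀ t → just t ≼ t
  ≼-refl t (_ , t≉t) = t≉t Eq.refl

  ≼-weaken : ∀ m {t t'} → m ≼ t → t ≤ t' → m ≼ t'
  ≼-weaken nothing  m≼t _ _ = m≼t _
  ≼-weaken (just x) x≼t t≤t' (t'≤x , t'≉x) =
    x≼t (≤-trans t≤t' t'≤x , λ t≈x → t'≉x (antisym t'≤x (≤-trans (reflexive (Eq.sym t≈x)) t≤t')))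

  ≼-lower : ∀ m {t t'} → Above G m t → m ≼ t' → just t ≼ t'
  ≼-lower nothing  _ m≼t' _ = m≼t' _
  ≼-lower (just x) (t≤x , t≉x) x≼t' (t'≤t , t'≉t) =
    x≼t' (≤-trans t'≤t t≤x , λ t'≈x → t≉x (antisym t≤x (≤-trans (reflexive (Eq.sym t'≈x)) t'≤t)))

  -- By totality, a ≼ b is classically a ≤ b; this suffices for negative goals.
  ≼⇒¬¬≤ : ∀ {a b} → just a ≼ b → ¬ ¬ (a ≤ b)
  ≼⇒¬¬≤ {a} {b} a≼b a≰b with total a b
  ... | inj₁ a≤b = a≰b a≤b
  ... | inj₂ b≤a = a≼b (b≤a , λ b≈a → a≰b (reflexive (Eq.sym b≈a)))

  Estimate : Set c
  Estimate = Fin n → Maybe Time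

  -- σ ⊑ σ': σ' satisfies every bound of σ; the BFS only ever lowers σ.
  _⊑_ : Estimate → Estimate → Set (c ⊔ ℓ₁ ⊔ ℓ₂)
  σ ⊑ σ' = ∀ w {t} → σ w ≼ t → σ' w ≼ t

  ⊑-refl : ∀ {σ} → σ ⊑ σ
  ⊑-refl _ σw≼t = σw≼t

  ⊑-lower : ∀ σ v {t} → Above G (σ v) t → σ ⊑ upd σ v (just t)
  ⊑-lower σ v {t} above w σw≼t' with upd-case σ v (just t) w
  ... | inj₁ (refl , eq) rewrite eq = ≼-lower (σ w) above σw≼t'
  ... | inj₂ (_    , eq) rewrite eq = σw≼t'

  upd-self-≼ : ∀ (σ : Estimate) v t → upd σ v (just t) v ≼ t
  upd-self-≼ σ v t with upd-case σ v (just t) v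
  ... | inj₁ (_ , eq) rewrite eq = ≼-refl t
  ... | inj₂ (v≢v , _) = ⊥₀-elim (v≢v refl)

  Settled : Estimate → Fin m → Set (ℓ₁ ⊔ ℓ₂)
  Settled σ e = σ (dst (edge e)) ≼ time (edge e)

  -- Record r is closed: every out-edge of vtx r no earlier than tm r is settled;
  -- ClosedOn restricts this to the out-neighbours marked in done.
  -- (Records rather than plain Π-types, so that σ, r and done are inferable.)
  record Closed (σ : Estimate) (r : Rec G) : Set (ℓ₁ ⊔ ℓ₂) where
    constructor closed
    field settles : ∀ e → src (edge e) ≡ vtx r → just (tm r) ≼ time (edge e) → Settled σ e

  record ClosedOn (done : Fin n → Bool) (σ : Estimate) (r : Rec G) : Set (ℓ₁ ⊔ ℓ₂) where
    constructor closedOn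
    field settles-done : ∀ e → src (edge e) ≡ vtx r → just (tm r) ≼ time (edge e) →
                         done (dst (edge e)) ≡ true → Settled σ e

  open Closed
  open ClosedOn

  closed-mono : ∀ {σ σ' r} → σ ⊑ σ' → Closed σ r → Closed σ' r
  closed-mono σ⊑σ' r-closed = closed λ e e-src e-late → σ⊑σ' _ (settles r-closed e e-src e-late)

  Processing : Estimate → Maybe (ℕ × (Fin n → Bool)) → ℕ → Rec G → Set (ℓ₁ ⊔ ℓ₂)
  Processing σ nothing           k r = ⊥
  Processing σ (just (i , done)) k r = k ≡ i × ClosedOn done σ r

  Status : Estimate → List ℕ → Maybe (ℕ × (Fin n → Bool)) → ℕ → Rec G → Set (ℓ₁ ⊔ ℓ₂)
  Status σ q cu k r = k ∈ q ⊎ Processing σ cu k r ⊎ Closed σ r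

  Occurs : List (Rec G) → Fin n → Time → Set c
  Occurs rs w x = ∃ λ k → ∃ λ r → at rs k ≡ just r × vtx r ≡ w × tm r ≡ x

  traverse-settled : ∀ {σ σ' tr u τ v j} → σ ⊑ σ' → MinE G tr u τ v j → σ' v ≼ time (edge j) →
                     (∀ {e} → tr e ≡ true → Settled σ e) →
                     ∀ {e} → upd tr j true e ≡ true → Settled σ' e
  traverse-settled {σ' = σ'} {tr = tr} {j = j} σ⊑σ' ((_ , j-dst , _) , _) v-bound settled {e} e-trav
    with upd-case tr j true e
  ... | inj₁ (refl , _) = subst (λ w → σ' w ≼ time (edge j)) (sym j-dst) v-bound
  ... | inj₂ (_ , eq)   = σ⊑σ' _ (settled (trans (sym eq) e-trav))

  -- ... and the current record becomes closed on v as well: an out-edge to v is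
  -- either already traversed, or lies in E_{vtx r, v} and so is no earlier than j.
  traverse-closedOn : ∀ {σ σ' tr done} {r : Rec G} {v j} → σ ⊑ σ' → MinE G tr (vtx r) (tm r) v j →
                      σ' v ≼ time (edge j) → (∀ {e} → tr e ≡ true → Settled σ e) →
                      ClosedOn done σ r → ClosedOn (upd done v true) σ' r
  traverse-closedOn {σ' = σ'} {tr} {done} {r} {v} {j} σ⊑σ' (_ , j-min) v-bound settled r-closedOn =
    closedOn settles-v
    where
    settles-v : ∀ e → src (edge e) ≡ vtx r → just (tm r) ≼ time (edge e) →
                upd done v true (dst (edge e)) ≡ true → Settled σ' e
    settles-v e e-src e-late e-done with upd-case done v true (dst (edge e))
    ... | inj₂ (_ , eq) = σ⊑σ' _ (settles-done r-closedOn e e-src e-late (trans (sym eq) e-done))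
    ... | inj₁ (e-dst , _) = λ above → ≼⇒¬¬≤ e-late (rule-out above)
      where
      rule-out : Above G (σ' (dst (edge e))) (time (edge e)) → tm r ≤ time (edge e) → ⊥₀
      rule-out above tm≤t with tr e in tr-e
      ... | true  = σ⊑σ' _ (settled tr-e) above
      ... | false = ≼-weaken (σ' v) v-bound (j-min e (e-src , e-dst , tr-e , tm≤t))
                      (subst (λ w → Above G (σ' w) (time (edge e))) e-dst above)

  finish-closed : ∀ {σ tr done} {r : Rec G} → (∀ {e} → tr e ≡ true → Settled σ e) → ClosedOn done σ r →
                  (∀ v j → done v ≡ false → ¬ InE G tr (vtx r) (tm r) v j) → Closed σ r
  finish-closed {tr = tr} {done} {r} settled r-closedOn exhausted =
    closed λ e e-src e-late above → ≼⇒¬¬≤ e-late (rule-out e e-src e-late above)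
    where
    rule-out : ∀ e → src (edge e) ≡ vtx r → just (tm r) ≼ time (edge e) →
               Above G _ (time (edge e)) → tm r ≤ time (edge e) → ⊥₀
    rule-out e e-src e-late above tm≤t with tr e in tr-e | done (dst (edge e)) in done-e
    ... | true  | _     = settled tr-e above
    ... | false | true  = settles-done r-closedOn e e-src e-late done-e above
    ... | false | false = exhausted (dst (edge e)) e done-e (e-src , refl , tr-e , tm≤t)

  status-step : ∀ {σ σ' q q' i done done'} (rs : List (Rec G)) {r k r'} → (∀ {x} → x ∈ q → x ∈ q') → σ ⊑ σ' →
                at rs i ≡ just r → (ClosedOn done σ r → ClosedOn done' σ' r) → at rs k ≡ just r' →
                Status σ q (just (i , done)) k r' → Status σ' q' (just (i , done')) k r'
  status-step _ q⊆q' _ _ _ _ (inj₁ k∈q) = inj₁ (q⊆q' k∈q)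
  status-step _ _ σ⊑σ' _ _ _ (inj₂ (inj₂ r'-closed)) = inj₂ (inj₂ (closed-mono σ⊑σ' r'-closed))
  status-step _ _ _ at-i keep at-k (inj₂ (inj₁ (refl , r'-closedOn))) with trans (sym at-k) at-i
  ... | refl = inj₂ (inj₁ (refl , keep r'-closedOn))

  module FromSource (s : Fin n) (ts : Time) where

    Sound : Fin n → Time → Set (c ⊔ ℓ₂)
    Sound v τ = ∀ w → Walk G v τ w → Walk G s ts w

    extend-sound : ∀ {u τ v} j → Sound u τ → src (edge j) ≡ u → τ ≤ time (edge j) →
                   dst (edge j) ≡ v → Sound v (time (edge j))
    extend-sound j sound-u j-src τ≤t refl w walk = sound-u w (step j j-src τ≤t walk)

    record Invariant (σ : Estimate) (tr : Fin m → Bool) (rs : List (Rec G)) (q : List ℕ)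
                     (cu : Maybe (ℕ × (Fin n → Bool))) : Set (c ⊔ ℓ₁ ⊔ ℓ₂) where
      field
        sound     : ∀ {k r} → at rs k ≡ just r → Sound (vtx r) (tm r)
        witnessed : ∀ {w x} → σ w ≡ just x → Occurs rs w x
        settled   : ∀ {e} → tr e ≡ true → Settled σ e
        status    : ∀ {k r} → at rs k ≡ just r → Status σ q cu k r
        root      : σ s ≼ ts
    open Invariant

    Inv : State G → Set (c ⊔ ℓ₁ ⊔ ℓ₂)
    Inv (state σ tr rs q cu) = Invariant σ tr rs q cu

    initial-invariant : Inv (initial G s ts)
    initial-invariant = record
      { sound = λ { {zero} refl w walk → walk ; {suc _} () }
      ; witnessed = witnessed₀
      ; settled = λ ()
      ; status = λ { {zero} refl → inj₁ (here refl) ; {suc _} () }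
      ; root = upd-self-≼ (λ _ → nothing) s ts }
      where
      witnessed₀ : ∀ {w x} → upd (λ _ → nothing) s (just ts) w ≡ just x →
                   Occurs [ rec s 0 ts nothing ] w x
      witnessed₀ {w} σw with upd-case (λ _ → nothing) s (just ts) w
      ... | inj₁ (w≡s , eq) = 0 , _ , refl , sym w≡s , just-injective (trans (sym eq) σw)
      ... | inj₂ (_ , eq) with trans (sym eq) σw
      ... | ()

    pop-preserves : ∀ {σ tr rs i q} → Invariant σ tr rs (i ∷ q) nothing →
                    Invariant σ tr rs q (just (i , λ _ → false))
    pop-preserves {σ} {_} {rs} {i} {q} I = record
      { sound = sound I ; witnessed = witnessed I ; settled = settled I
      ; status = status' ; root = root I }
      where
      status' : ∀ {k r} → at rs k ≡ just r → Status σ q (just (i , λ _ → false)) k r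
      status' at-k with status I at-k
      ... | inj₁ (here refl)     = inj₂ (inj₁ (refl , closedOn λ _ _ _ ()))
      ... | inj₁ (there k∈q)     = inj₁ k∈q
      ... | inj₂ (inj₁ absurd)   = ⊥-elim absurd
      ... | inj₂ (inj₂ r-closed) = inj₂ (inj₂ r-closed)

    finish-preserves : ∀ {σ tr rs q i done} {r : Rec G} → at rs i ≡ just r →
                       (∀ v j → done v ≡ false → ¬ InE G tr (vtx r) (tm r) v j) →
                       Invariant σ tr rs q (just (i , done)) → Invariant σ tr rs q nothing
    finish-preserves {σ} {_} {rs} {q} at-i exhausted I = record
      { sound = sound I ; witnessed = witnessed I ; settled = settled I
      ; status = status' ; root = root I }
      where
      status' : ∀ {k r'} → at rs k ≡ just r' → Status σ q nothing k r'
      status' at-k with status I at-k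
      ... | inj₁ k∈q                      = inj₁ k∈q
      ... | inj₂ (inj₂ r'-closed)         = inj₂ (inj₂ r'-closed)
      ... | inj₂ (inj₁ (refl , r-closedOn)) with trans (sym at-k) at-i
      ... | refl = inj₂ (inj₂ (finish-closed (settled I) r-closedOn exhausted))

    skip-preserves : ∀ {σ tr rs q i done} {r : Rec G} {v j} → at rs i ≡ just r →
                     MinE G tr (vtx r) (tm r) v j → σ v ≼ time (edge j) →
                     Invariant σ tr rs q (just (i , done)) →
                     Invariant σ (upd tr j true) rs q (just (i , upd done v true))
    skip-preserves {rs = rs} at-i minE v-bound I = record
      { sound = sound I ; witnessed = witnessed I
      ; settled = traverse-settled ⊑-refl minE v-bound (settled I)
      ; status = λ at-k → status-step rs (λ k∈q → k∈q) ⊑-refl at-i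
                            (traverse-closedOn ⊑-refl minE v-bound (settled I)) at-k (status I at-k)
      ; root = root I }

    push-preserves : ∀ {σ tr rs q i done} {r : Rec G} {v j} → at rs i ≡ just r →
                     MinE G tr (vtx r) (tm r) v j → Above G (σ v) (time (edge j)) →
                     Invariant σ tr rs q (just (i , done)) →
                     Invariant (upd σ v (just (time (edge j)))) (upd tr j true)
                               (rs ++ [ rec v (suc (hop r)) (time (edge j)) (just i) ])
                               (q ++ [ length rs ]) (just (i , upd done v true))
    push-preserves {σ} {_} {rs} {q} {i} {done} {r} {v} {j}
                   at-i minE@((j-src , j-dst , _ , tm≤t) , _) above I = record
      { sound = sound'
      ; witnessed = witnessed'
      ; settled = traverse-settled σ⊑σ' minE (upd-self-≼ σ v t) (settled I)
      ; status = status'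
      ; root = σ⊑σ' s (root I) }
      where
      t : Time
      t = time (edge j)
      σ' : Estimate
      σ' = upd σ v (just t)
      new : Rec G
      new = rec v (suc (hop r)) t (just i)
      σ⊑σ' : σ ⊑ σ'
      σ⊑σ' = ⊑-lower σ v above

      sound' : ∀ {k r'} → at (rs ++ [ new ]) k ≡ just r' → Sound (vtx r') (tm r')
      sound' at-k with at-snoc-inv rs at-k
      ... | inj₁ at-k-old  = sound I at-k-old
      ... | inj₂ (_ , refl) = extend-sound j (sound I at-i) j-src tm≤t j-dst

      witnessed' : ∀ {w x} → σ' w ≡ just x → Occurs (rs ++ [ new ]) w x
      witnessed' {w} σ'w with upd-case σ v (just t) w
      ... | inj₁ (refl , eq) =
        length rs , new , at-snoc-last rs new , refl , just-injective (trans (sym eq) σ'w)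
      ... | inj₂ (_ , eq) with witnessed I (trans (sym eq) σ'w)
      ... | k , r' , at-k , vtx≡ , tm≡ = k , r' , at-++ˡ rs at-k , vtx≡ , tm≡

      status' : ∀ {k r'} → at (rs ++ [ new ]) k ≡ just r' →
                Status σ' (q ++ [ length rs ]) (just (i , upd done v true)) k r'
      status' at-k with at-snoc-inv rs at-k
      ... | inj₁ at-k-old =
        status-step rs ∈-++⁺ˡ σ⊑σ' at-i (traverse-closedOn σ⊑σ' minE (upd-self-≼ σ v t) (settled I))
                    at-k-old (status I at-k-old)
      ... | inj₂ (refl , _) = inj₁ (∈-++⁺ʳ q (here refl))

    update-preserves : ∀ {σ tr rs q i done} {r : Rec G} {v j k} → at rs i ≡ just r →
                       MinE G tr (vtx r) (tm r) v j → Above G (σ v) (time (edge j)) →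
                       HasQ G rs q v (suc (hop r)) k →
                       Invariant σ tr rs q (just (i , done)) →
                       Invariant (upd σ v (just (time (edge j)))) (upd tr j true)
                                 (setAt rs k (rec v (suc (hop r)) (time (edge j)) (just i)))
                                 q (just (i , upd done v true))
    update-preserves {σ} {_} {rs} {q} {i} {done} {r} {v} {j} {k}
                     at-i minE@((j-src , j-dst , _ , tm≤t) , _) above
                     (k∈q , _ , at-k , vtx-old , _) I = record
      { sound = sound'
      ; witnessed = witnessed'
      ; settled = traverse-settled σ⊑σ' minE (upd-self-≼ σ v t) (settled I)
      ; status = status'
      ; root = σ⊑σ' s (root I) }
      where
      t : Time
      t = time (edge j)
      σ' : Estimate
      σ' = upd σ v (just t)
      new : Rec G
      new = rec v (suc (hop r)) t (just i)
      σ⊑σ' : σ ⊑ σ'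
      σ⊑σ' = ⊑-lower σ v above

      sound' : ∀ {k' r'} → at (setAt rs k new) k' ≡ just r' → Sound (vtx r') (tm r')
      sound' at-k' with at-setAt-inv rs k at-k'
      ... | inj₁ (_ , refl) = extend-sound j (sound I at-i) j-src tm≤t j-dst
      ... | inj₂ at-k'-old  = sound I at-k'-old

      -- A witness of w ≠ v cannot sit at slot k, which holds a record of v.
      witnessed' : ∀ {w x} → σ' w ≡ just x → Occurs (setAt rs k new) w x
      witnessed' {w} σ'w with upd-case σ v (just t) w
      ... | inj₁ (refl , eq) =
        k , new , at-setAt-here rs k at-k , refl , just-injective (trans (sym eq) σ'w)
      ... | inj₂ (w≢v , eq) with witnessed I (trans (sym eq) σ'w)
      ... | k' , r' , at-k' , vtx≡ , tm≡ with k' ≟ℕ k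
      ... | no k'≢k = k' , r' , trans (at-setAt-there rs k k'≢k) at-k' , vtx≡ , tm≡
      ... | yes refl with trans (sym at-k') at-k
      ... | refl = ⊥₀-elim (w≢v (trans (sym vtx≡) vtx-old))

      status' : ∀ {k' r'} → at (setAt rs k new) k' ≡ just r' →
                Status σ' q (just (i , upd done v true)) k' r'
      status' at-k' with at-setAt-inv rs k at-k'
      ... | inj₁ (refl , _) = inj₁ k∈q
      ... | inj₂ at-k'-old =
        status-step rs (λ k∈q' → k∈q') σ⊑σ' at-i
                    (traverse-closedOn σ⊑σ' minE (upd-self-≼ σ v t) (settled I))
                    at-k'-old (status I at-k'-old)

    invariant-step : ∀ {st st'} → Step G st st' → Inv st → Inv st'
    invariant-step pop = pop-preserves
    invariant-step (finish at-i exhausted) = finish-preserves at-i exhausted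
    invariant-step (skip at-i _ minE v-bound) = skip-preserves at-i minE v-bound
    invariant-step (push at-i _ minE above _) = push-preserves at-i minE above
    invariant-step (update at-i _ minE above inQ) = update-preserves at-i minE above inQ

    invariant-run : ∀ {st st'} → Star (Step G) st st' → Inv st → Inv st'
    invariant-run ε         I = I
    invariant-run (x ◅ run) I = invariant-run run (invariant-step x I)

    terminal-closed : ∀ {σ tr rs} → Invariant σ tr rs [] nothing →
                      ∀ {k r} → at rs k ≡ just r → Closed σ r
    terminal-closed I at-k with status I at-k
    ... | inj₁ ()
    ... | inj₂ (inj₁ absurd)   = ⊥-elim absurd
    ... | inj₂ (inj₂ r-closed) = r-closed

    occurrence-below : ∀ {σ tr rs q cu w t} → Invariant σ tr rs q cu → σ w ≼ t →
                       ∃ λ k → ∃ λ r → at rs k ≡ just r × vtx r ≡ w × just (tm r) ≼ t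
    occurrence-below {σ = σ} {w = w} I σw≼t with σ w in σw
    ... | nothing = ⊥₀-elim (σw≼t _)
    ... | just x with witnessed I σw
    ... | k , r , at-k , vtx≡ , refl = k , r , at-k , vtx≡ , σw≼t

    walk-in-tree : ∀ {σ tr rs} → Invariant σ tr rs [] nothing →
                   ∀ {x t y k r} → Walk G x t y → at rs k ≡ just r → vtx r ≡ x →
                   just (tm r) ≼ t → InTree G rs y
    walk-in-tree I stay at-k vtx≡ _ = _ , at⇒∈ at-k , vtx≡
    walk-in-tree I (step e e-src t≤te walk) at-k vtx≡ tm≼t
      with occurrence-below I (settles (terminal-closed I at-k) e (trans e-src (sym vtx≡))
                                        (≼-weaken _ tm≼t t≤te))
    ... | k' , r' , at-k' , vtx'≡ , tm'≼ = walk-in-tree I walk at-k' vtx'≡ tm'≼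

    reachable⇒in-tree : ∀ {σ tr rs} → Invariant σ tr rs [] nothing →
                        ∀ {v} → Reachable G s ts v → InTree G rs v
    reachable⇒in-tree I walk with occurrence-below I (root I)
    ... | k , r , at-k , vtx≡ , tm≼ = walk-in-tree I walk at-k vtx≡ tm≼

    in-tree⇒reachable : ∀ {σ tr rs q cu} → Invariant σ tr rs q cu →
                        ∀ {v} → InTree G rs v → Reachable G s ts v
    in-tree⇒reachable I (r , r∈rs , refl) with ∈⇒at r∈rs
    ... | k , at-k = sound I at-k (vtx r) stay

lemma11 : ∀ {c ℓ₁ ℓ₂} (O : TotalOrder c ℓ₁ ℓ₂) (G : Temporal.TemporalGraph O)
          (s : Temporal.Vtx O G) (ts : TotalOrder.Carrier O)
          (rs : List (Temporal.Rec O G)) →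
          Temporal.BFSRun O G s ts rs →
          ∀ v → (Temporal.InTree O G rs v → Temporal.Reachable O G s ts v)
              × (Temporal.Reachable O G s ts v → Temporal.InTree O G rs v)
lemma11 O G s ts rs (σ , tr , run) v = in-tree⇒reachable I , reachable⇒in-tree I
  where
  open BFSInvariant O G
  open FromSource s ts
  I : Invariant σ tr rs [] nothing
  I = invariant-run run initial-invariant
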